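{- Let $k\ge2$ be an integer and let $F$ be a field with more than $k$ distinct elements whose characteristic does not divide $k$. Every polynomial $P\in F[x,y]$ of degree $d$ admits a decomposition $$P=\delta_1Q_1^k+\cdots+\delta_sQ_s^k$$ with $\delta_1,\ldots,\delta_s\in F$, $Q_1,\ldots,Q_s\in F[x,y]$, $\deg Q_i^k\le d+2(k-1)^2$ and $s\le k\cdot\frac{(d+1)(d+2)}{2}$. If moreover every element of $F$ is a sum of $k$th powers of elements of $F$, then $P$ admits a decomposition $$P=Q_1^k+\cdots+Q_s^k$$ with $Q_1,\ldots,Q_s\in F[x,y]$, $\deg Q_i^k\le d+2(k-1)^2$ and $s\le k\,w_F(k)\frac{(d+1)(d+2)}{2}$.
   Context: $w_F(k)$ denotes the least integer $s$ such that every element of $F$ is a sum of $s$ $k$th powers of elements of $F$ ($w_F(k)=\infty$ if no such $s$ exists). -}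

module Defs where

open import Level using (Level; _⊔_) renaming (suc to lsuc)
open import Data.Nat using (ℕ; zero; suc; _+_; _∸_; _<_)
open import Data.Fin using (Fin)
import Data.Fin as Fin
open import Data.Product using (Σ; ∃; _×_; _,_)
open import Relation.Nullary using (¬_)
open import Algebra.Bundles using (CommutativeRing)
open import Relation.Binary.PropositionalEquality using (_≡_)

record Field (c ℓ : Level) : Set (lsuc (c ⊔ ℓ)) where
  field
    cring : CommutativeRing c ℓ
  open CommutativeRing cring public
  field
    1≉0     : ¬ (1# ≈ 0#)
    inverse : ∀ x → ¬ (x ≈ 0#) → Σ Carrier λ y → (x * y) ≈ 1#

module FieldDefs {c ℓ : Level} (F : Field c ℓ) where
  open Field F using (Carrier; _≈_; 0#; 1#) renaming (_+_ to _+F_; _*_ to _*F_)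

  pow : Carrier → ℕ → Carrier
  pow x zero    = 1#
  pow x (suc n) = x *F pow x n

  natF : ℕ → Carrier
  natF zero    = 0#
  natF (suc n) = 1# +F natF n

  -- "the characteristic of F divides k"  ⇔  k · 1 = 0 in F
  CharDivides : ℕ → Set ℓ
  CharDivides k = natF k ≈ 0#

  MoreThan : ℕ → Set (c ⊔ ℓ)
  MoreThan k = Σ (Fin (suc k) → Carrier) λ e → ∀ i j → e i ≈ e j → i ≡ j

  sumFin : (n : ℕ) → (Fin n → Carrier) → Carrier
  sumFin zero    f = 0#
  sumFin (suc n) f = f Fin.zero +F sumFin n (λ i → f (Fin.suc i))

  sumUpTo : ℕ → (ℕ → Carrier) → Carrier
  sumUpTo zero    f = f 0
  sumUpTo (suc n) f = f (suc n) +F sumUpTo n f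

  SumOfPowers : ℕ → ℕ → Carrier → Set (c ⊔ ℓ)
  SumOfPowers k s a = Σ (Fin s → Carrier) λ v → sumFin s (λ i → pow (v i) k) ≈ a

  IsWaringNumber : ℕ → ℕ → Set (c ⊔ ℓ)
  IsWaringNumber k w =
    (∀ a → SumOfPowers k w a) × (∀ s → s < w → ¬ (∀ a → SumOfPowers k s a))

  -- Bivariate polynomials over F, given by coefficient functions:
  -- P i j = coefficient of x^i y^j.  A genuine polynomial has finite
  -- support (IsPoly).
  Poly : Set c
  Poly = ℕ → ℕ → Carrier

  DegLe : Poly → ℕ → Set ℓ
  DegLe P d = ∀ i j → d < i + j → P i j ≈ 0#

  IsPoly : Poly → Set ℓ
  IsPoly P = ∃ λ N → DegLe P N

  _≈P_ : Poly → Poly → Set ℓ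
  P ≈P Q = ∀ i j → P i j ≈ Q i j

  _+P_ : Poly → Poly → Poly
  (P +P Q) i j = P i j +F Q i j

  _·P_ : Carrier → Poly → Poly
  (δ ·P P) i j = δ *F P i j

  _*P_ : Poly → Poly → Poly
  (P *P Q) i j = sumUpTo i λ a → sumUpTo j λ b → P a b *F Q (i ∸ a) (j ∸ b)

  oneP : Poly
  oneP zero zero = 1#
  oneP _    _    = 0#

  zeroP : Poly
  zeroP _ _ = 0#

  powP : Poly → ℕ → Poly
  powP P zero    = oneP
  powP P (suc n) = P *P powP P n

  sumP : (s : ℕ) → (Fin s → Poly) → Poly
  sumP zero    f = zeroP
  sumP (suc s) f = f Fin.zero +P sumP s (λ i → f (Fin.suc i))

module Submission where

-- Choose k distinct nodes c_t with
-- Σ_t c_t = 0 and weights L_t solving the Vandermonde system μ_e = [e = k-1]/k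
-- (e < k) for the moments μ_e = Σ_t L_t c_t^e; then also μ_k = (1/k) Σ_t c_t = 0.
-- By the binomial theorem, Σ_t L_t (M + c_t N)^k = M N^(k-1) for all monomials M, N.
-- Writing I = r + a k, J = r′ + b k with 0 ≤ r, r′ < k and taking N = x^a y^b,
-- M = x^(a+r) y^(b+r′) gives x^I y^J as a combination of k k-th powers of
-- polynomials Q with deg Q^k ≤ I + J + 2(k-1)².  Summing over the (d+1)(d+2)/2
-- monomials of P gives the first claim; if every scalar is a sum of w k-th powers,
-- each term δ Q^k splits into w pure powers (v Q)^k, giving the second.

open import Defs
open import Level using (Level; _⊔_)
open import Data.Nat using (ℕ; zero; suc; _+_; _*_; _∸_; _≤_; _<_; z≤n; s≤s; _≟_; _≤?_)
open import Data.Nat.Properties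
  using (≤-refl; ≤-trans; ≤-reflexive; ≤-pred; <-irrefl; ≰⇒>; m≤n⇒m≤1+n; ≤∧≢⇒<; <⇒≱; m+n∸n≡m)
import Data.Nat.Properties as ℕ
open import Data.Nat.Tactic.RingSolver using (solve-∀)
open import Data.Nat.DivMod using (_/_; _%_; m≡m%n+[m/n]*n; m%n<n)
open import Data.Fin using (Fin; _↑ˡ_; _↑ʳ_)
import Data.Fin as Fin
open import Data.Fin.Properties using (suc-injective; inject₁-injective)
open import Data.Vec.Functional using (_++_)
open import Data.Vec.Functional.Properties using (lookup-++ˡ; lookup-++ʳ)
open import Data.Vec.Functional.Relation.Unary.All.Properties using (++⁺)
open import Data.Product using (Σ; ∃; _×_; _,_; proj₁; proj₂)
open import Data.Empty using (⊥; ⊥-elim)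
open import Relation.Nullary using (¬_; yes; no)
open import Relation.Binary.PropositionalEquality as ≡ using (_≡_; _≢_)

sumUpToℕ : ℕ → (ℕ → ℕ) → ℕ
sumUpToℕ zero    f = f 0
sumUpToℕ (suc n) f = f (suc n) + sumUpToℕ n f

sumUpToℕ-const : ∀ k m → sumUpToℕ m (λ _ → k) ≡ suc m * k
sumUpToℕ-const k zero    = ≡.sym (ℕ.+-identityʳ k)
sumUpToℕ-const k (suc m) = ≡.cong (k +_) (sumUpToℕ-const k m)

-- k copies of every monomial x^I y^(m-I) with m ≤ d: twice their number is
-- k (d+1)(d+2).
monomialCount : ∀ k d → sumUpToℕ d (λ m → sumUpToℕ m (λ _ → k)) * 2 ≡ k * ((d + 1) * (d + 2))
monomialCount k zero    = solve-∀
monomialCount k (suc d) = begin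
  (sumUpToℕ (suc d) (λ _ → k) + rest) * 2  ≡⟨ ≡.cong (λ z → (z + rest) * 2) (sumUpToℕ-const k (suc d)) ⟩
  (suc (suc d) * k + rest) * 2             ≡⟨ ℕ.*-distribʳ-+ 2 (suc (suc d) * k) rest ⟩
  suc (suc d) * k * 2 + rest * 2           ≡⟨ ≡.cong (suc (suc d) * k * 2 +_) (monomialCount k d) ⟩
  suc (suc d) * k * 2 + k * ((d + 1) * (d + 2)) ≡⟨ step k d ⟩
  k * ((suc d + 1) * (suc d + 2))          ∎
  where
  open ≡.≡-Reasoning
  rest : ℕ
  rest = sumUpToℕ d (λ m → sumUpToℕ m (λ _ → k))
  step : ∀ k d → suc (suc d) * k * 2 + k * ((d + 1) * (d + 2)) ≡ k * ((suc d + 1) * (suc d + 2))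
  step = solve-∀

-- Exponents of M^l N^(n-l) for M = x^(A+r), N = x^A, as M or N is multiplied in.
exponent-raise : ∀ n l A r → n * A + l * r + (A + r) ≡ suc n * A + suc l * r
exponent-raise = solve-∀

exponent-grow : ∀ n l A r → n * A + l * r + A ≡ suc n * A + l * r
exponent-grow = solve-∀

-- The exponent of M N^(k-1) is k a + r, which recovers I = r + a k.
exponent-one : ∀ k a r → k * a + 1 * r ≡ r + a * k
exponent-one = solve-∀

-- For l ≤ k₁ + 1 and r, r′ ≤ k₁ the exponents of M^l N^(k-l) exceed in total those of
-- x^(r + a k) y^(r′ + b k) by at most 2 k₁².
exponentBound : ∀ k₁ a b r r′ l → r ≤ k₁ → r′ ≤ k₁ → l ≤ suc k₁ →
  (suc k₁ * a + l * r) + (suc k₁ * b + l * r′) ≤ (r + a * suc k₁) + (r′ + b * suc k₁) + 2 * (k₁ * k₁)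
exponentBound k₁ a b r r′ l r≤k₁ r′≤k₁ l≤k =
  ≤-trans (ℕ.+-mono-≤ (excess a r r≤k₁) (excess b r′ r′≤k₁)) (≤-reflexive (regroup (suc k₁) a b r r′ (k₁ * k₁)))
  where
  -- l y ≤ (k₁ + 1) y = y + k₁ y ≤ y + k₁²
  excess : ∀ x y → y ≤ k₁ → suc k₁ * x + l * y ≤ suc k₁ * x + (y + k₁ * k₁)
  excess x y y≤k₁ = ℕ.+-monoʳ-≤ (suc k₁ * x) (≤-trans (ℕ.*-monoˡ-≤ y l≤k) (ℕ.+-monoʳ-≤ y (ℕ.*-monoʳ-≤ k₁ y≤k₁)))
  regroup : ∀ k a b r r′ m → (k * a + (r + m)) + (k * b + (r′ + m)) ≡ (r + a * k) + (r′ + b * k) + 2 * m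
  regroup = solve-∀

-- The count after splitting each of s terms into w terms.
scaleCount : ∀ k w X s → s * 2 ≡ k * X → s * w * 2 ≡ k * w * X
scaleCount k w X s s2≡kX = ≡.trans (reorder s w) (≡.trans (≡.cong (_* w) s2≡kX) (reorder′ k X w))
  where
  reorder : ∀ s w → s * w * 2 ≡ s * 2 * w
  reorder = solve-∀
  reorder′ : ∀ k X w → k * X * w ≡ k * w * X
  reorder′ = solve-∀

module Development {c ℓ : Level} (F : Field c ℓ) where
  open Field F renaming (_+_ to _+F_; _*_ to _*F_)
  open FieldDefs F
  open import Relation.Binary.Reasoning.Setoid setoid
  open import Algebra.Properties.Ring ring using (-‿distribˡ-*; -‿distribʳ-*)
  open import Algebra.Properties.AbelianGroup +-abelianGroup using (xyx⁻¹≈y; ∙-cancelʳ; x∙y⁻¹≈ε⇒x≈y)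
  open import Algebra.Properties.CommutativeSemigroup *-commutativeSemigroup
    using (xy∙z≈xz∙y) renaming (interchange to *-interchange; x∙yz≈y∙xz to *-swapˡ)
  open import Algebra.Properties.CommutativeSemigroup +-commutativeSemigroup
    using () renaming (interchange to +-interchange)
  open import Algebra.Properties.Semiring.Sum semiring
    using (sum; sum-cong-≋; ∑-distrib-+; *-distribˡ-sum; *-distribʳ-sum)

  sumUpTo-cong : ∀ n {f g : ℕ → Carrier} → (∀ l → l ≤ n → f l ≈ g l) → sumUpTo n f ≈ sumUpTo n g
  sumUpTo-cong zero    h = h 0 z≤n
  sumUpTo-cong (suc n) h = +-cong (h (suc n) ≤-refl) (sumUpTo-cong n (λ l l≤n → h l (m≤n⇒m≤1+n l≤n)))

  sumUpTo-zero : ∀ n {f : ℕ → Carrier} → (∀ l → l ≤ n → f l ≈ 0#) → sumUpTo n f ≈ 0#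
  sumUpTo-zero n h = trans (sumUpTo-cong n h) (constZero n)
    where
    constZero : ∀ n → sumUpTo n (λ _ → 0#) ≈ 0#
    constZero zero    = refl
    constZero (suc n) = trans (+-identityˡ _) (constZero n)

  sumUpTo-+ : ∀ n (f g : ℕ → Carrier) → sumUpTo n (λ l → f l +F g l) ≈ sumUpTo n f +F sumUpTo n g
  sumUpTo-+ zero    f g = refl
  sumUpTo-+ (suc n) f g = trans (+-congˡ (sumUpTo-+ n f g)) (+-interchange _ _ _ _)

  *-distribˡ-sumUpTo : ∀ n x (f : ℕ → Carrier) → x *F sumUpTo n f ≈ sumUpTo n (λ l → x *F f l)
  *-distribˡ-sumUpTo zero    x f = refl
  *-distribˡ-sumUpTo (suc n) x f = trans (distribˡ x _ _) (+-congˡ (*-distribˡ-sumUpTo n x f))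

  sumUpTo-peel : ∀ n (f : ℕ → Carrier) → sumUpTo (suc n) f ≈ sumUpTo n (λ l → f (suc l)) +F f 0
  sumUpTo-peel zero    f = refl
  sumUpTo-peel (suc n) f = trans (+-congˡ (sumUpTo-peel n f)) (sym (+-assoc _ _ _))

  *-distribˡ-sumUpTo² : ∀ i j x (G : ℕ → ℕ → Carrier) →
    sumUpTo i (λ a → sumUpTo j (λ b → x *F G a b)) ≈ x *F sumUpTo i (λ a → sumUpTo j (G a))
  *-distribˡ-sumUpTo² i j x G =
    sym (trans (*-distribˡ-sumUpTo i x _) (sumUpTo-cong i (λ a _ → *-distribˡ-sumUpTo j x (G a))))

  sumUpTo²-+ : ∀ i j (G H : ℕ → ℕ → Carrier) →
    sumUpTo i (λ a → sumUpTo j (λ b → G a b +F H a b))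
      ≈ sumUpTo i (λ a → sumUpTo j (G a)) +F sumUpTo i (λ a → sumUpTo j (H a))
  sumUpTo²-+ i j G H = trans (sumUpTo-cong i (λ a _ → sumUpTo-+ j (G a) (H a))) (sumUpTo-+ i _ _)

  sumFin≈sum : ∀ n (f : Fin n → Carrier) → sumFin n f ≈ sum f
  sumFin≈sum zero    f = refl
  sumFin≈sum (suc n) f = +-congˡ (sumFin≈sum n (λ t → f (Fin.suc t)))

  sum-sumUpTo-comm : ∀ s n (g : Fin s → ℕ → Carrier) →
    sum (λ t → sumUpTo n (g t)) ≈ sumUpTo n (λ l → sum (λ t → g t l))
  sum-sumUpTo-comm zero    n g = sym (sumUpTo-zero n (λ _ _ → refl))
  sum-sumUpTo-comm (suc s) n g = begin
    sumUpTo n (g Fin.zero) +F sum (λ t → sumUpTo n (g (Fin.suc t)))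
      ≈⟨ +-congˡ (sum-sumUpTo-comm s n (λ t → g (Fin.suc t))) ⟩
    sumUpTo n (g Fin.zero) +F sumUpTo n (λ l → sum (λ t → g (Fin.suc t) l))
      ≈⟨ sumUpTo-+ n _ _ ⟨
    sumUpTo n (λ l → sum (λ t → g t l)) ∎

  sum-+const : ∀ n (f : Fin n → Carrier) m → sum (λ t → f t +F m) ≈ sum f +F natF n *F m
  sum-+const zero    f m = sym (trans (+-identityˡ _) (zeroˡ m))
  sum-+const (suc n) f m = begin
    (f Fin.zero +F m) +F sum (λ t → f (Fin.suc t) +F m)
      ≈⟨ +-congˡ (sum-+const n (λ t → f (Fin.suc t)) m) ⟩
    (f Fin.zero +F m) +F (sum (λ t → f (Fin.suc t)) +F natF n *F m)
      ≈⟨ +-interchange _ _ _ _ ⟩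
    sum f +F (m +F natF n *F m)
      ≈⟨ +-congˡ (trans (+-congʳ (sym (*-identityˡ m))) (sym (distribʳ m 1# (natF n)))) ⟩
    sum f +F natF (suc n) *F m ∎

  δ : ℕ → ℕ → Carrier
  δ zero    zero    = 1#
  δ zero    (suc _) = 0#
  δ (suc _) zero    = 0#
  δ (suc a) (suc x) = δ a x

  𝟙≤ : ℕ → ℕ → Carrier
  𝟙≤ zero    _       = 1#
  𝟙≤ (suc a) zero    = 0#
  𝟙≤ (suc a) (suc n) = 𝟙≤ a n

  δ-refl : ∀ a → δ a a ≡ 1#
  δ-refl zero    = ≡.refl
  δ-refl (suc a) = δ-refl a

  δ-≢ : ∀ a x → a ≢ x → δ a x ≡ 0#
  δ-≢ zero    zero    a≢x = ⊥-elim (a≢x ≡.refl)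
  δ-≢ zero    (suc x) _   = ≡.refl
  δ-≢ (suc a) zero    _   = ≡.refl
  δ-≢ (suc a) (suc x) a≢x = δ-≢ a x (λ e → a≢x (≡.cong suc e))

  δ-sym : ∀ a x → δ a x ≡ δ x a
  δ-sym zero    zero    = ≡.refl
  δ-sym zero    (suc x) = ≡.refl
  δ-sym (suc a) zero    = ≡.refl
  δ-sym (suc a) (suc x) = δ-sym a x

  𝟙≤-yes : ∀ a n → a ≤ n → 𝟙≤ a n ≡ 1#
  𝟙≤-yes zero    n       _       = ≡.refl
  𝟙≤-yes (suc a) (suc n) (s≤s p) = 𝟙≤-yes a n p

  𝟙≤-no : ∀ a n → n < a → 𝟙≤ a n ≡ 0#
  𝟙≤-no (suc a) zero    _       = ≡.refl
  𝟙≤-no (suc a) (suc n) (s≤s p) = 𝟙≤-no a n p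

  𝟙≤-step : ∀ a n → a ≢ suc n → 𝟙≤ a (suc n) ≡ 𝟙≤ a n
  𝟙≤-step a n a≢1+n with a ≤? n
  ... | yes a≤n = ≡.trans (𝟙≤-yes a (suc n) (m≤n⇒m≤1+n a≤n)) (≡.sym (𝟙≤-yes a n a≤n))
  ... | no  a≰n = ≡.trans (𝟙≤-no a (suc n) 1+n<a) (≡.sym (𝟙≤-no a n (≰⇒> a≰n)))
    where
    1+n<a : suc n < a
    1+n<a = ≤∧≢⇒< (≰⇒> a≰n) (λ e → a≢1+n (≡.sym e))

  𝟙≤-δ : ∀ a p i → 𝟙≤ a i *F δ p (i ∸ a) ≈ δ (p + a) i
  𝟙≤-δ zero    p i       = trans (*-identityˡ _) (reflexive (≡.cong (λ z → δ z i) (≡.sym (ℕ.+-identityʳ p))))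
  𝟙≤-δ (suc a) p zero    rewrite ℕ.+-suc p a = zeroˡ _
  𝟙≤-δ (suc a) p (suc i) = trans (𝟙≤-δ a p i) (reflexive (≡.cong (λ z → δ z (suc i)) (≡.sym (ℕ.+-suc p a))))

  sift : ∀ n a (f : ℕ → Carrier) → sumUpTo n (λ x → δ a x *F f x) ≈ 𝟙≤ a n *F f a
  sift zero    zero    f = refl
  sift zero    (suc a) f = trans (zeroˡ _) (sym (zeroˡ _))
  sift (suc n) a f with a ≟ suc n
  ... | yes ≡.refl = begin
      δ a a *F f a +F sumUpTo n (λ x → δ a x *F f x)
        ≈⟨ +-cong (*-congʳ (reflexive (δ-refl a))) (sift n a f) ⟩
      1# *F f a +F 𝟙≤ a n *F f a
        ≈⟨ +-congˡ (trans (*-congʳ (reflexive (𝟙≤-no a n ≤-refl))) (zeroˡ _)) ⟩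
      1# *F f a +F 0#
        ≈⟨ +-identityʳ _ ⟩
      1# *F f a
        ≈⟨ *-congʳ (reflexive (𝟙≤-yes a a ≤-refl)) ⟨
      𝟙≤ a a *F f a ∎
  ... | no a≢1+n = begin
      δ a (suc n) *F f (suc n) +F sumUpTo n (λ x → δ a x *F f x)
        ≈⟨ +-cong (trans (*-congʳ (reflexive (δ-≢ a (suc n) a≢1+n))) (zeroˡ _)) (sift n a f) ⟩
      0# +F 𝟙≤ a n *F f a
        ≈⟨ +-identityˡ _ ⟩
      𝟙≤ a n *F f a
        ≈⟨ *-congʳ (reflexive (𝟙≤-step a n a≢1+n)) ⟨
      𝟙≤ a (suc n) *F f a ∎

  δδ-zero : ∀ p q i j → (p ≡ i → q ≡ j → ⊥) → δ p i *F δ q j ≈ 0#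
  δδ-zero p q i j h with p ≟ i | q ≟ j
  ... | no p≢i  | _        = trans (*-congʳ (reflexive (δ-≢ p i p≢i))) (zeroˡ _)
  ... | yes _   | no q≢j   = trans (*-congˡ (reflexive (δ-≢ q j q≢j))) (zeroʳ _)
  ... | yes p≡i | yes q≡j  = ⊥-elim (h p≡i q≡j)

  mono : ℕ → ℕ → Poly
  mono a b i j = δ a i *F δ b j

  oneP≈mono : oneP ≈P mono 0 0
  oneP≈mono zero    zero    = sym (*-identityˡ 1#)
  oneP≈mono zero    (suc j) = sym (zeroʳ _)
  oneP≈mono (suc i) zero    = sym (zeroˡ _)
  oneP≈mono (suc i) (suc j) = sym (zeroˡ _)

  *P-congʳ : ∀ Q {R R' : Poly} → R ≈P R' → (Q *P R) ≈P (Q *P R')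
  *P-congʳ Q R≈R' i j = sumUpTo-cong i (λ x _ → sumUpTo-cong j (λ y _ → *-congˡ (R≈R' (i ∸ x) (j ∸ y))))

  *P-linearˡ : ∀ P Q v R i j → ((P +P (v ·P Q)) *P R) i j ≈ (P *P R) i j +F v *F (Q *P R) i j
  *P-linearˡ P Q v R i j = begin
    ((P +P (v ·P Q)) *P R) i j
      ≈⟨ sumUpTo-cong i (λ x _ → sumUpTo-cong j (λ y _ → trans (distribʳ _ _ _) (+-congˡ (*-assoc _ _ _)))) ⟩
    sumUpTo i (λ x → sumUpTo j (λ y → P x y *F R (i ∸ x) (j ∸ y) +F v *F (Q x y *F R (i ∸ x) (j ∸ y))))
      ≈⟨ sumUpTo²-+ i j _ _ ⟩
    (P *P R) i j +F sumUpTo i (λ x → sumUpTo j (λ y → v *F (Q x y *F R (i ∸ x) (j ∸ y))))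
      ≈⟨ +-congˡ (*-distribˡ-sumUpTo² i j v _) ⟩
    (P *P R) i j +F v *F (Q *P R) i j ∎

  mono-*P : ∀ a b (R : Poly) i j → (mono a b *P R) i j ≈ 𝟙≤ a i *F (𝟙≤ b j *F R (i ∸ a) (j ∸ b))
  mono-*P a b R i j = begin
    sumUpTo i (λ x → sumUpTo j (λ y → (δ a x *F δ b y) *F R (i ∸ x) (j ∸ y)))
      ≈⟨ sumUpTo-cong i (λ x _ → inner x) ⟩
    sumUpTo i (λ x → δ a x *F (𝟙≤ b j *F R (i ∸ x) (j ∸ b)))
      ≈⟨ sift i a (λ x → 𝟙≤ b j *F R (i ∸ x) (j ∸ b)) ⟩
    𝟙≤ a i *F (𝟙≤ b j *F R (i ∸ a) (j ∸ b)) ∎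
    where
    inner : ∀ x → sumUpTo j (λ y → (δ a x *F δ b y) *F R (i ∸ x) (j ∸ y))
                  ≈ δ a x *F (𝟙≤ b j *F R (i ∸ x) (j ∸ b))
    inner x = begin
      sumUpTo j (λ y → (δ a x *F δ b y) *F R (i ∸ x) (j ∸ y))
        ≈⟨ sumUpTo-cong j (λ y _ → trans (*-congʳ (*-comm _ _)) (*-assoc _ _ _)) ⟩
      sumUpTo j (λ y → δ b y *F (δ a x *F R (i ∸ x) (j ∸ y)))
        ≈⟨ sift j b (λ y → δ a x *F R (i ∸ x) (j ∸ y)) ⟩
      𝟙≤ b j *F (δ a x *F R (i ∸ x) (j ∸ b))
        ≈⟨ *-swapˡ _ _ _ ⟩
      δ a x *F (𝟙≤ b j *F R (i ∸ x) (j ∸ b)) ∎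

  monomialSum : ℕ → (ℕ → Carrier) → (ℕ → ℕ) → (ℕ → ℕ) → Poly
  monomialSum n g p q i j = sumUpTo n (λ l → g l *F mono (p l) (q l) i j)

  monomialSum-shift : ∀ n a b i j g p q →
    𝟙≤ a i *F (𝟙≤ b j *F monomialSum n g p q (i ∸ a) (j ∸ b))
      ≈ monomialSum n g (λ l → p l + a) (λ l → q l + b) i j
  monomialSum-shift n a b i j g p q = begin
    𝟙≤ a i *F (𝟙≤ b j *F monomialSum n g p q (i ∸ a) (j ∸ b))
      ≈⟨ trans (*-congˡ (*-distribˡ-sumUpTo n _ _)) (*-distribˡ-sumUpTo n _ _) ⟩
    sumUpTo n (λ l → 𝟙≤ a i *F (𝟙≤ b j *F (g l *F (δ (p l) (i ∸ a) *F δ (q l) (j ∸ b)))))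
      ≈⟨ sumUpTo-cong n (λ l _ → trans (regroup _ _ _ _ _) (*-congˡ (*-cong (𝟙≤-δ a (p l) i) (𝟙≤-δ b (q l) j)))) ⟩
    monomialSum n g (λ l → p l + a) (λ l → q l + b) i j ∎
    where
    regroup : ∀ s t u x y → s *F (t *F (u *F (x *F y))) ≈ u *F ((s *F x) *F (t *F y))
    regroup s t u x y = begin
      s *F (t *F (u *F (x *F y))) ≈⟨ *-congˡ (*-swapˡ t u _) ⟩
      s *F (u *F (t *F (x *F y))) ≈⟨ *-swapˡ s u _ ⟩
      u *F (s *F (t *F (x *F y))) ≈⟨ *-congˡ (*-assoc s t _) ⟨
      u *F ((s *F t) *F (x *F y)) ≈⟨ *-congˡ (*-interchange s t x y) ⟩
      u *F ((s *F x) *F (t *F y)) ∎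

  monomialSum-degree : ∀ n g p q D → (∀ l → l ≤ n → p l + q l ≤ D) → DegLe (monomialSum n g p q) D
  monomialSum-degree n g p q D bound i j D<i+j =
    sumUpTo-zero n (λ l l≤n → trans (*-congˡ (δδ-zero (p l) (q l) i j (λ { ≡.refl ≡.refl →
      <⇒≱ D<i+j (bound l l≤n) }))) (zeroʳ _))

  monomialExpansion : ∀ d P → DegLe P d →
    P ≈P (λ i j → sumUpTo d (λ m → sumUpTo m (λ I → P I (m ∸ I) *F mono I (m ∸ I) i j)))
  monomialExpansion d P degP i j = sym (begin
    sumUpTo d (λ m → sumUpTo m (λ I → P I (m ∸ I) *F (δ I i *F δ (m ∸ I) j)))
      ≈⟨ sumUpTo-cong d (λ m _ → diagonal m) ⟩
    sumUpTo d (λ m → δ (j + i) m *F P i (m ∸ i))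
      ≈⟨ sift d (j + i) (λ m → P i (m ∸ i)) ⟩
    𝟙≤ (j + i) d *F P i ((j + i) ∸ i)
      ≈⟨ *-congˡ (reflexive (≡.cong (P i) (m+n∸n≡m j i))) ⟩
    𝟙≤ (j + i) d *F P i j
      ≈⟨ inRange ⟩
    P i j ∎)
    where
    diagonal : ∀ m → sumUpTo m (λ I → P I (m ∸ I) *F (δ I i *F δ (m ∸ I) j)) ≈ δ (j + i) m *F P i (m ∸ i)
    diagonal m = begin
      sumUpTo m (λ I → P I (m ∸ I) *F (δ I i *F δ (m ∸ I) j))
        ≈⟨ sumUpTo-cong m (λ I _ → trans (*-swapˡ _ _ _) (*-congʳ (reflexive (δ-sym I i)))) ⟩
      sumUpTo m (λ I → δ i I *F (P I (m ∸ I) *F δ (m ∸ I) j))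
        ≈⟨ sift m i (λ I → P I (m ∸ I) *F δ (m ∸ I) j) ⟩
      𝟙≤ i m *F (P i (m ∸ i) *F δ (m ∸ i) j)
        ≈⟨ trans (*-swapˡ _ _ _) (*-congˡ (*-congˡ (reflexive (δ-sym (m ∸ i) j)))) ⟩
      P i (m ∸ i) *F (𝟙≤ i m *F δ j (m ∸ i))
        ≈⟨ *-congˡ (𝟙≤-δ i j m) ⟩
      P i (m ∸ i) *F δ (j + i) m
        ≈⟨ *-comm _ _ ⟩
      δ (j + i) m *F P i (m ∸ i) ∎
    inRange : 𝟙≤ (j + i) d *F P i j ≈ P i j
    inRange with j + i ≤? d
    ... | yes j+i≤d = trans (*-congʳ (reflexive (𝟙≤-yes _ _ j+i≤d))) (*-identityˡ _)
    ... | no  j+i≰d = trans (*-congʳ (reflexive (𝟙≤-no _ _ (≰⇒> j+i≰d))))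
          (trans (zeroˡ _) (sym (degP i j (≡.subst (d <_) (ℕ.+-comm j i) (≰⇒> j+i≰d)))))

  binom : ℕ → ℕ → Carrier
  binom zero    zero    = 1#
  binom zero    (suc l) = 0#
  binom (suc n) zero    = 1#
  binom (suc n) (suc l) = binom n l +F binom n (suc l)

  binom-0 : ∀ n → binom n 0 ≡ 1#
  binom-0 zero    = ≡.refl
  binom-0 (suc n) = ≡.refl

  binom-over : ∀ n l → n < l → binom n l ≈ 0#
  binom-over zero    (suc l) _       = refl
  binom-over (suc n) (suc l) (s≤s p) =
    trans (+-cong (binom-over n l p) (binom-over n (suc l) (m≤n⇒m≤1+n p))) (+-identityˡ 0#)

  binom-1 : ∀ n → binom n 1 ≈ natF n
  binom-1 zero    = refl
  binom-1 (suc n) = +-cong (reflexive (binom-0 n)) (binom-1 n)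

  -- The binomial theorem for Q_v = M + v N with M = x^(A+r) y^(B+r'), N = x^A y^B:
  -- Q_v^n = Σ_{l≤n} C(n,l) v^(n-l) M^l N^(n-l), where M^l N^(n-l) = x^(nA+lr) y^(nB+lr').
  module Binomial (A B r r' : ℕ) (v : Carrier) where
    Qv : Poly
    Qv = mono (A + r) (B + r') +P (v ·P mono A B)

    expX expY : ℕ → ℕ → ℕ
    expX n l = n * A + l * r
    expY n l = n * B + l * r'

    binomialSum : ℕ → (ℕ → Carrier) → Poly
    binomialSum n g = monomialSum n g (expX n) (expY n)

    row : ℕ → ℕ → Carrier
    row n l = binom n l *F pow v (n ∸ l)

    Qv-*-binomialSum : ∀ n g i j → (Qv *P binomialSum n g) i j
      ≈ monomialSum n (λ l → g l) (λ l → expX (suc n) (suc l)) (λ l → expY (suc n) (suc l)) i j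
        +F v *F monomialSum n g (expX (suc n)) (expY (suc n)) i j
    Qv-*-binomialSum n g i j = begin
      (Qv *P R) i j
        ≈⟨ *P-linearˡ (mono (A + r) (B + r')) (mono A B) v R i j ⟩
      (mono (A + r) (B + r') *P R) i j +F v *F (mono A B *P R) i j
        ≈⟨ +-cong (mono-*P (A + r) (B + r') R i j) (*-congˡ (mono-*P A B R i j)) ⟩
      𝟙≤ (A + r) i *F (𝟙≤ (B + r') j *F R (i ∸ (A + r)) (j ∸ (B + r')))
        +F v *F (𝟙≤ A i *F (𝟙≤ B j *F R (i ∸ A) (j ∸ B)))
        ≈⟨ +-cong (monomialSum-shift n (A + r) (B + r') i j g (expX n) (expY n))
                  (*-congˡ (monomialSum-shift n A B i j g (expX n) (expY n))) ⟩
      monomialSum n g (λ l → expX n l + (A + r)) (λ l → expY n l + (B + r')) i j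
        +F v *F monomialSum n g (λ l → expX n l + A) (λ l → expY n l + B) i j
        ≈⟨ +-cong (sumUpTo-cong n (λ l _ → *-congˡ (reflexive (≡.cong₂ (λ a b → mono a b i j)
                    (exponent-raise n l A r) (exponent-raise n l B r')))))
                  (*-congˡ (sumUpTo-cong n (λ l _ → *-congˡ (reflexive (≡.cong₂ (λ a b → mono a b i j)
                    (exponent-grow n l A r) (exponent-grow n l B r')))))) ⟩
      monomialSum n g (λ l → expX (suc n) (suc l)) (λ l → expY (suc n) (suc l)) i j
        +F v *F monomialSum n g (expX (suc n)) (expY (suc n)) i j ∎
      where R = binomialSum n g

    v-*-row : ∀ n (T : ℕ → Carrier) →
      v *F sumUpTo n (λ l → row n l *F T l)
        ≈ sumUpTo n (λ l → (binom n (suc l) *F pow v (n ∸ l)) *F T (suc l)) +F row (suc n) 0 *F T 0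
    v-*-row n T = begin
      v *F sumUpTo n (λ l → row n l *F T l)
        ≈⟨ *-distribˡ-sumUpTo n v _ ⟩
      sumUpTo n (λ l → v *F (row n l *F T l))
        ≈⟨ sumUpTo-cong n (λ l l≤n → trans (sym (*-assoc _ _ _)) (*-congʳ (trans (*-swapˡ _ _ _)
             (*-congˡ (reflexive (≡.cong (pow v) (≡.sym (ℕ.+-∸-assoc 1 l≤n)))))))) ⟩
      sumUpTo n h
        ≈⟨ +-identityˡ _ ⟨
      0# +F sumUpTo n h
        ≈⟨ +-congʳ (sym (trans (*-congʳ (trans (*-congʳ (binom-over n (suc n) ≤-refl)) (zeroˡ _))) (zeroˡ _))) ⟩
      sumUpTo (suc n) h
        ≈⟨ sumUpTo-peel n h ⟩
      sumUpTo n (λ l → h (suc l)) +F h 0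
        ≈⟨ +-congˡ (*-congʳ (*-congʳ (reflexive (binom-0 n)))) ⟩
      sumUpTo n (λ l → (binom n (suc l) *F pow v (n ∸ l)) *F T (suc l)) +F row (suc n) 0 *F T 0 ∎
      where
      h : ℕ → Carrier
      h l = (binom n l *F pow v (suc n ∸ l)) *F T l

    -- Pascal's rule combines the two sums of Qv-*-binomialSum into the next row.
    pascal : ∀ n i j →
      monomialSum n (row n) (λ l → expX (suc n) (suc l)) (λ l → expY (suc n) (suc l)) i j
        +F v *F monomialSum n (row n) (expX (suc n)) (expY (suc n)) i j
        ≈ binomialSum (suc n) (row (suc n)) i j
    pascal n i j = begin
      sumUpTo n (λ l → row n l *F T (suc l)) +F v *F sumUpTo n (λ l → row n l *F T l)
        ≈⟨ +-congˡ (v-*-row n T) ⟩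
      sumUpTo n (λ l → row n l *F T (suc l))
        +F (sumUpTo n (λ l → (binom n (suc l) *F pow v (n ∸ l)) *F T (suc l)) +F row (suc n) 0 *F T 0)
        ≈⟨ +-assoc _ _ _ ⟨
      (sumUpTo n (λ l → row n l *F T (suc l))
        +F sumUpTo n (λ l → (binom n (suc l) *F pow v (n ∸ l)) *F T (suc l))) +F row (suc n) 0 *F T 0
        ≈⟨ +-congʳ (sym (trans (sumUpTo-cong n (λ l _ → trans (*-congʳ (distribʳ _ _ _)) (distribʳ _ _ _)))
                                (sumUpTo-+ n _ _))) ⟩
      sumUpTo n (λ l → row (suc n) (suc l) *F T (suc l)) +F row (suc n) 0 *F T 0
        ≈⟨ sumUpTo-peel n (λ l → row (suc n) l *F T l) ⟨
      binomialSum (suc n) (row (suc n)) i j ∎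
      where
      T : ℕ → Carrier
      T l = mono (expX (suc n) l) (expY (suc n) l) i j

    binomialTheorem : ∀ n → powP Qv n ≈P binomialSum n (row n)
    binomialTheorem zero i j = trans (oneP≈mono i j) (sym (trans (*-congʳ (*-identityˡ 1#)) (*-identityˡ _)))
    binomialTheorem (suc n) i j = begin
      (Qv *P powP Qv n) i j                 ≈⟨ *P-congʳ Qv (binomialTheorem n) i j ⟩
      (Qv *P binomialSum n (row n)) i j      ≈⟨ Qv-*-binomialSum n (row n) i j ⟩
      _                                      ≈⟨ pascal n i j ⟩
      binomialSum (suc n) (row (suc n)) i j ∎

    Qv-isPoly : IsPoly Qv
    Qv-isPoly = (A + r) + (B + r') , λ i j lt → trans
      (+-cong (δδ-zero (A + r) (B + r') i j (λ { ≡.refl ≡.refl → <-irrefl ≡.refl lt }))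
              (trans (*-congˡ (δδ-zero A B i j (λ { ≡.refl ≡.refl → <⇒≱ lt
                 (ℕ.+-mono-≤ (ℕ.m≤m+n A r) (ℕ.m≤m+n B r')) }))) (zeroʳ _)))
      (+-identityˡ 0#)

  moment : (n : ℕ) → (Fin n → Carrier) → (Fin n → Carrier) → ℕ → Carrier
  moment n c L e = sum (λ t → L t *F pow (c t) e)

  reducedWeights : ∀ {n} → (Fin (suc n) → Carrier) → (Fin (suc n) → Carrier) → Fin n → Carrier
  reducedWeights c L t = L (Fin.suc t) *F (c (Fin.suc t) +F (- c Fin.zero))

  weight-split : ∀ L c′ c₀ p → L *F (c′ *F p) ≈ c₀ *F (L *F p) +F (L *F (c′ +F (- c₀))) *F p
  weight-split L c′ c₀ p = sym (begin
    c₀ *F (L *F p) +F (L *F (c′ +F (- c₀))) *F p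
      ≈⟨ +-cong (*-swapˡ c₀ L p) (trans (*-assoc _ _ _) (*-congˡ (distribʳ p c′ (- c₀)))) ⟩
    L *F (c₀ *F p) +F L *F (c′ *F p +F (- c₀) *F p)
      ≈⟨ +-congˡ (trans (distribˡ _ _ _) (+-congˡ (trans (*-congˡ (sym (-‿distribˡ-* c₀ p)))
                                                        (sym (-‿distribʳ-* L _))))) ⟩
    L *F (c₀ *F p) +F (L *F (c′ *F p) +F (- (L *F (c₀ *F p))))
      ≈⟨ cancel _ _ ⟩
    L *F (c′ *F p) ∎)
    where
    cancel : ∀ a b → a +F (b +F (- a)) ≈ b
    cancel a b = trans (sym (+-assoc a b (- a))) (xyx⁻¹≈y a b)

  moment-step : ∀ n (c L : Fin (suc n) → Carrier) e →
    moment (suc n) c L (suc e)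
      ≈ c Fin.zero *F moment (suc n) c L e +F moment n (λ t → c (Fin.suc t)) (reducedWeights c L) e
  moment-step n c L e = begin
    L Fin.zero *F (c₀ *F pow c₀ e) +F sum (λ t → L (Fin.suc t) *F (c (Fin.suc t) *F pow (c (Fin.suc t)) e))
      ≈⟨ +-cong (*-swapˡ _ _ _) (sum-cong-≋ {n} (λ t → weight-split _ _ _ _)) ⟩
    c₀ *F (L Fin.zero *F pow c₀ e) +F sum (λ t → c₀ *F rest t +F reducedTerm t)
      ≈⟨ +-congˡ (∑-distrib-+ {n} (λ t → c₀ *F rest t) reducedTerm) ⟩
    c₀ *F (L Fin.zero *F pow c₀ e) +F (sum (λ t → c₀ *F rest t) +F sum reducedTerm)
      ≈⟨ +-congˡ (+-congʳ (*-distribˡ-sum {n} c₀ rest)) ⟨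
    c₀ *F (L Fin.zero *F pow c₀ e) +F (c₀ *F sum rest +F sum reducedTerm)
      ≈⟨ trans (sym (+-assoc _ _ _)) (+-congʳ (sym (distribˡ _ _ _))) ⟩
    c₀ *F moment (suc n) c L e +F moment n (λ t → c (Fin.suc t)) (reducedWeights c L) e ∎
    where
    c₀ : Carrier
    c₀ = c Fin.zero
    rest reducedTerm : Fin n → Carrier
    rest t        = L (Fin.suc t) *F pow (c (Fin.suc t)) e
    reducedTerm t = reducedWeights c L t *F pow (c (Fin.suc t)) e

  moment-next : ∀ n (c L : Fin (suc n) → Carrier) κ →
    (∀ e → e < n → moment (suc n) c L e ≈ 0#) → moment (suc n) c L n ≈ κ →
    moment (suc n) c L (suc n) ≈ κ *F sum c
  moment-next zero c L κ _ μ₀≈κ = begin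
    moment 1 c L 1                  ≈⟨ moment-step 0 c L 0 ⟩
    c Fin.zero *F moment 1 c L 0 +F 0# ≈⟨ +-identityʳ _ ⟩
    c Fin.zero *F moment 1 c L 0    ≈⟨ *-congˡ μ₀≈κ ⟩
    c Fin.zero *F κ                 ≈⟨ *-comm _ _ ⟩
    κ *F c Fin.zero                 ≈⟨ *-congˡ (+-identityʳ _) ⟨
    κ *F (c Fin.zero +F 0#)         ∎
  moment-next (suc n) c L κ lower μₙ≈κ = begin
    μ (suc (suc n))                       ≈⟨ moment-step (suc n) c L (suc n) ⟩
    c₀ *F μ (suc n) +F μ′ (suc n)         ≈⟨ +-cong (*-congˡ μₙ≈κ) (moment-next n c′ (reducedWeights c L) κ lower′ μ′ₙ≈κ) ⟩
    c₀ *F κ +F κ *F sum c′                ≈⟨ +-congʳ (*-comm _ _) ⟩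
    κ *F c₀ +F κ *F sum c′                ≈⟨ distribˡ _ _ _ ⟨
    κ *F sum c                            ∎
    where
    μ μ′ : ℕ → Carrier
    μ  = moment (suc (suc n)) c L
    c₀ : Carrier
    c₀ = c Fin.zero
    c′ : Fin (suc n) → Carrier
    c′ t = c (Fin.suc t)
    μ′ = moment (suc n) c′ (reducedWeights c L)
    reduced : ∀ e {w} → μ (suc e) ≈ w → μ e ≈ 0# → μ′ e ≈ w
    reduced e {w} μₑ₊₁≈w μₑ≈0 = begin
      μ′ e                          ≈⟨ +-identityˡ _ ⟨
      0# +F μ′ e                    ≈⟨ +-congʳ (trans (*-congˡ μₑ≈0) (zeroʳ c₀)) ⟨
      c₀ *F μ e +F μ′ e             ≈⟨ moment-step (suc n) c L e ⟨
      μ (suc e)                     ≈⟨ μₑ₊₁≈w ⟩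
      w                             ∎
    lower′ : ∀ e → e < n → μ′ e ≈ 0#
    lower′ e e<n = reduced e (lower (suc e) (s≤s e<n)) (lower e (m≤n⇒m≤1+n e<n))
    μ′ₙ≈κ : μ′ n ≈ κ
    μ′ₙ≈κ = reduced n μₙ≈κ (lower n ≤-refl)

  vandermonde : ∀ n (c : Fin n → Carrier) → (∀ s t → c s ≈ c t → s ≡ t) → (τ : ℕ → Carrier) →
    Σ (Fin n → Carrier) λ L → ∀ e → e < n → moment n c L e ≈ τ e
  vandermonde zero    c distinct τ = (λ ()) , λ e ()
  vandermonde (suc n) c distinct τ = L , attains
    where
    c₀ : Carrier
    c₀ = c Fin.zero
    c′ : Fin n → Carrier
    c′ t = c (Fin.suc t)
    τ′ : ℕ → Carrier
    τ′ e = τ (suc e) +F (- (c₀ *F τ e))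
    reducedSolution : Σ (Fin n → Carrier) λ ν → ∀ e → e < n → moment n c′ ν e ≈ τ′ e
    reducedSolution = vandermonde n c′ (λ s t e → suc-injective (distinct _ _ e)) τ′
    ν : Fin n → Carrier
    ν = proj₁ reducedSolution
    gap≉0 : ∀ t → ¬ (c′ t +F (- c₀) ≈ 0#)
    gap≉0 t gap≈0 with distinct _ _ (x∙y⁻¹≈ε⇒x≈y _ _ gap≈0)
    ... | ()
    gap⁻¹ : Fin n → Carrier
    gap⁻¹ t = proj₁ (inverse (c′ t +F (- c₀)) (gap≉0 t))
    L : Fin (suc n) → Carrier
    L Fin.zero    = τ 0 +F (- sum (λ t → ν t *F gap⁻¹ t))
    L (Fin.suc t) = ν t *F gap⁻¹ t
    reduced≈ν : ∀ t → reducedWeights c L t ≈ ν t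
    reduced≈ν t = trans (*-assoc _ _ _)
      (trans (*-congˡ (trans (*-comm _ _) (proj₂ (inverse (c′ t +F (- c₀)) (gap≉0 t))))) (*-identityʳ _))
    attains : ∀ e → e < suc n → moment (suc n) c L e ≈ τ e
    attains zero _ = begin
      L Fin.zero *F 1# +F sum (λ t → L (Fin.suc t) *F 1#)
        ≈⟨ +-cong (*-identityʳ _) (sum-cong-≋ {n} (λ t → *-identityʳ _)) ⟩
      (τ 0 +F (- sum (λ t → L (Fin.suc t)))) +F sum (λ t → L (Fin.suc t))
        ≈⟨ trans (+-assoc _ _ _) (trans (+-congˡ (-‿inverseˡ _)) (+-identityʳ _)) ⟩
      τ 0 ∎
    attains (suc e) (s≤s e<n) = begin
      moment (suc n) c L (suc e)
        ≈⟨ moment-step n c L e ⟩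
      c₀ *F moment (suc n) c L e +F moment n c′ (reducedWeights c L) e
        ≈⟨ +-cong (*-congˡ (attains e (m≤n⇒m≤1+n e<n)))
                  (trans (sum-cong-≋ {n} (λ t → *-congʳ (reduced≈ν t))) (proj₂ reducedSolution e e<n)) ⟩
      c₀ *F τ e +F (τ (suc e) +F (- (c₀ *F τ e)))
        ≈⟨ trans (sym (+-assoc _ _ _)) (xyx⁻¹≈y _ _) ⟩
      τ (suc e) ∎

  -- Nodes c and weights L with C(k,l) μ_(k-l)(c, L) = δ(1, l) for every l; by the binomial
  -- theorem this says exactly Σ_t L_t (M + c_t N)^k = M N^(k-1) for commuting M, N.
  BinomialWeights : (k : ℕ) → (Fin k → Carrier) → (Fin k → Carrier) → Set ℓ
  BinomialWeights k c L = ∀ l → binom k l *F moment k c L (k ∸ l) ≈ δ 1 l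

  -- If |F| > k ≥ 2 and char F ∤ k, such nodes and weights exist: take k distinct nodes
  -- with Σ_t c_t = 0, choose L (Vandermonde) with μ_e = [e = k-1]/k for e < k; then
  -- μ_k = (1/k) Σ_t c_t = 0 by moment-next.
  binomialWeights : ∀ k₂ → MoreThan (suc (suc k₂)) → ¬ CharDivides (suc (suc k₂)) →
    Σ (Fin (suc (suc k₂)) → Carrier) λ c → Σ (Fin (suc (suc k₂)) → Carrier) λ L →
      BinomialWeights (suc (suc k₂)) c L
  binomialWeights k₂ (e , e-injective) k≉0 = node , L , weightsOK
    where
    k₁ k : ℕ
    k₁ = suc k₂
    k  = suc k₁
    κ : Carrier
    κ = proj₁ (inverse (natF k) k≉0)
    kκ≈1 : natF k *F κ ≈ 1#
    kκ≈1 = proj₂ (inverse (natF k) k≉0)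
    -- k distinct elements, translated to have sum 0
    e′ : Fin k → Carrier
    e′ t = e (Fin.inject₁ t)
    shift : Carrier
    shift = - (sum e′ *F κ)
    node : Fin k → Carrier
    node t = e′ t +F shift
    node-sum≈0 : sum node ≈ 0#
    node-sum≈0 = begin
      sum node                                ≈⟨ sum-+const k e′ shift ⟩
      sum e′ +F natF k *F shift               ≈⟨ +-congˡ (sym (-‿distribʳ-* _ _)) ⟩
      sum e′ +F (- (natF k *F (sum e′ *F κ))) ≈⟨ +-congˡ (-‿cong (trans (*-swapˡ _ _ _) (trans (*-congˡ kκ≈1) (*-identityʳ _)))) ⟩
      sum e′ +F (- sum e′)                    ≈⟨ -‿inverseʳ _ ⟩
      0#                                      ∎
    node-distinct : ∀ s t → node s ≈ node t → s ≡ t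
    node-distinct s t cs≈ct = inject₁-injective (e-injective _ _ (∙-cancelʳ shift _ _ cs≈ct))
    solution : Σ (Fin k → Carrier) λ L → ∀ e → e < k → moment k node L e ≈ δ e k₁ *F κ
    solution = vandermonde k node node-distinct (λ x → δ x k₁ *F κ)
    L : Fin k → Carrier
    L = proj₁ solution
    μ : ℕ → Carrier
    μ = moment k node L
    μ-below : ∀ x → x < k₁ → μ x ≈ 0#
    μ-below x x<k₁ = trans (proj₂ solution x (m≤n⇒m≤1+n x<k₁))
      (trans (*-congʳ (reflexive (δ-≢ x k₁ (λ { ≡.refl → <-irrefl ≡.refl x<k₁ })))) (zeroˡ κ))
    μ-k₁ : μ k₁ ≈ κ
    μ-k₁ = trans (proj₂ solution k₁ ≤-refl) (trans (*-congʳ (reflexive (δ-refl k₁))) (*-identityˡ κ))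
    μ-k : μ k ≈ 0#
    μ-k = trans (moment-next k₁ node L κ μ-below μ-k₁) (trans (*-congˡ node-sum≈0) (zeroʳ κ))
    weightsOK : BinomialWeights k node L
    weightsOK zero             = trans (*-identityˡ _) μ-k
    weightsOK (suc zero)       = trans (*-cong (binom-1 k) μ-k₁) kκ≈1
    weightsOK (suc (suc l))    = trans (*-congˡ (μ-below (k₂ ∸ l) (s≤s (ℕ.m∸n≤m k₂ l)))) (zeroʳ _)

  sumP-cong : ∀ s {f g : Fin s → Poly} → (∀ t → f t ≈P g t) → sumP s f ≈P sumP s g
  sumP-cong zero    f≈g i j = refl
  sumP-cong (suc s) f≈g i j = +-cong (f≈g Fin.zero i j) (sumP-cong s (λ t → f≈g (Fin.suc t)) i j)

  sumP-split : ∀ m n (f : Fin (m + n) → Poly) →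
    sumP (m + n) f ≈P (sumP m (λ t → f (t ↑ˡ n)) +P sumP n (λ t → f (m ↑ʳ t)))
  sumP-split zero    n f i j = sym (+-identityˡ _)
  sumP-split (suc m) n f i j = trans (+-congˡ (sumP-split m n (λ t → f (Fin.suc t)) i j)) (sym (+-assoc _ _ _))

  sumP-coeff : ∀ s (f : Fin s → Poly) i j → sumP s f i j ≈ sum (λ t → f t i j)
  sumP-coeff zero    f i j = refl
  sumP-coeff (suc s) f i j = +-congˡ (sumP-coeff s (λ t → f (Fin.suc t)) i j)

  module _ {A : Set c} (term : A → Poly) (good : A → Set ℓ) where
    Decomposition : Poly → ℕ → Set (c ⊔ ℓ)
    Decomposition P s = Σ (Fin s → A) λ a → (∀ i → good (a i)) × (P ≈P sumP s (λ i → term (a i)))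

    decomposition-cong : ∀ {P P′ s} → P′ ≈P P → Decomposition P s → Decomposition P′ s
    decomposition-cong P′≈P (a , isGood , P≈Σ) = a , isGood , λ i j → trans (P′≈P i j) (P≈Σ i j)

    decomposition-++ : ∀ {P R s₁ s₂} → Decomposition P s₁ → Decomposition R s₂ → Decomposition (P +P R) (s₁ + s₂)
    decomposition-++ {s₁ = s₁} {s₂} (a₁ , good₁ , P≈Σ) (a₂ , good₂ , R≈Σ) =
      a₁ ++ a₂ , ++⁺ good good₁ good₂ , λ i j → trans (+-cong (P≈Σ i j) (R≈Σ i j)) (sym (begin
        sumP (s₁ + s₂) (λ t → term ((a₁ ++ a₂) t)) i j
          ≈⟨ sumP-split s₁ s₂ _ i j ⟩
        sumP s₁ (λ t → term ((a₁ ++ a₂) (t ↑ˡ s₂))) i j +F sumP s₂ (λ t → term ((a₁ ++ a₂) (s₁ ↑ʳ t))) i j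
          ≈⟨ +-cong (sumP-cong s₁ (λ t i j → reflexive (≡.cong (λ x → term x i j) (lookup-++ˡ a₁ a₂ t))) i j)
                    (sumP-cong s₂ (λ t i j → reflexive (≡.cong (λ x → term x i j) (lookup-++ʳ a₁ a₂ t))) i j) ⟩
        sumP s₁ (λ t → term (a₁ t)) i j +F sumP s₂ (λ t → term (a₂ t)) i j ∎))

    decomposition-sumUpTo : ∀ n (Ps : ℕ → Poly) (count : ℕ → ℕ) → (∀ l → l ≤ n → Decomposition (Ps l) (count l)) →
      Decomposition (λ i j → sumUpTo n (λ l → Ps l i j)) (sumUpToℕ n count)
    decomposition-sumUpTo zero    Ps count decompose = decompose 0 z≤n
    decomposition-sumUpTo (suc n) Ps count decompose = decomposition-++ (decompose (suc n) ≤-refl)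
      (decomposition-sumUpTo n Ps count (λ l l≤n → decompose l (m≤n⇒m≤1+n l≤n)))

  decomposition-refine : ∀ {A B : Set c} {term : A → Poly} {good : A → Set ℓ}
    {term′ : B → Poly} {good′ : B → Set ℓ} w →
    (∀ x → good x → Decomposition term′ good′ (term x) w) →
    ∀ {P} s → Decomposition term good P s → Decomposition term′ good′ P (s * w)
  decomposition-refine w refine zero    (a , _ , P≈0) = (λ ()) , (λ ()) , P≈0
  decomposition-refine {term = term} {good} {term′} {good′} w refine (suc s) (a , isGood , P≈Σ) =
    decomposition-cong term′ good′ P≈Σ (decomposition-++ term′ good′ (refine (a Fin.zero) (isGood Fin.zero))
      (decomposition-refine {term = term} {good} {term′} {good′} w refine s ((λ t → a (Fin.suc t)) , (λ t → isGood (Fin.suc t)) , λ i j → refl)))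

  Admissible : ℕ → ℕ → Poly → Set ℓ
  Admissible k D Q = IsPoly Q × DegLe (powP Q k) D

  scaledPower : ℕ → Carrier × Poly → Poly
  scaledPower k x = proj₁ x ·P powP (proj₂ x) k

  power : ℕ → Poly → Poly
  power k Q = powP Q k

  scaledForm : ∀ {k D P s} → Decomposition (scaledPower k) (λ x → Admissible k D (proj₂ x)) P s →
    Σ (Fin s → Carrier) λ δ → Σ (Fin s → Poly) λ Q →
      (∀ i → IsPoly (Q i)) × (∀ i → DegLe (powP (Q i) k) D) × (P ≈P sumP s (λ i → δ i ·P powP (Q i) k))
  scaledForm (a , admissible , P≈Σ) =
    (λ i → proj₁ (a i)) , (λ i → proj₂ (a i)) , (λ i → proj₁ (admissible i)) , (λ i → proj₂ (admissible i)) , P≈Σ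

  powerForm : ∀ {k D P s} → Decomposition (power k) (Admissible k D) P s →
    Σ (Fin s → Poly) λ Q →
      (∀ i → IsPoly (Q i)) × (∀ i → DegLe (powP (Q i) k) D) × (P ≈P sumP s (λ i → powP (Q i) k))
  powerForm (Q , admissible , P≈Σ) = Q , (λ i → proj₁ (admissible i)) , (λ i → proj₂ (admissible i)) , P≈Σ

  powP-scale : ∀ v Q n → powP (v ·P Q) n ≈P (pow v n ·P powP Q n)
  powP-scale v Q zero    i j = sym (*-identityˡ _)
  powP-scale v Q (suc n) i j = begin
    ((v ·P Q) *P powP (v ·P Q) n) i j
      ≈⟨ *P-congʳ (v ·P Q) (powP-scale v Q n) i j ⟩
    sumUpTo i (λ x → sumUpTo j (λ y → (v *F Q x y) *F (pow v n *F powP Q n (i ∸ x) (j ∸ y))))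
      ≈⟨ sumUpTo-cong i (λ x _ → sumUpTo-cong j (λ y _ → *-interchange _ _ _ _)) ⟩
    sumUpTo i (λ x → sumUpTo j (λ y → (v *F pow v n) *F (Q x y *F powP Q n (i ∸ x) (j ∸ y))))
      ≈⟨ *-distribˡ-sumUpTo² i j _ _ ⟩
    (v *F pow v n) *F (Q *P powP Q n) i j ∎

  admissible-scale : ∀ {k D} v Q → Admissible k D Q → Admissible k D (v ·P Q)
  admissible-scale {k} v Q ((N , degQ) , degQᵏ) =
    (N , λ i j N<i+j → trans (*-congˡ (degQ i j N<i+j)) (zeroʳ v)) ,
    λ i j D<i+j → trans (powP-scale v Q k i j) (trans (*-congˡ (degQᵏ i j D<i+j)) (zeroʳ _))

  scaledPower-asPowers : ∀ k D w → (∀ a → SumOfPowers k w a) →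
    ∀ x → Admissible k D (proj₂ x) → Decomposition (power k) (Admissible k D) (scaledPower k x) w
  scaledPower-asPowers k D w everySum (δ₀ , Q) admissibleQ =
    (λ l → v l ·P Q) , (λ l → admissible-scale {k} (v l) Q admissibleQ) , λ i j → sym (begin
      sumP w (λ l → powP (v l ·P Q) k) i j
        ≈⟨ sumP-cong w (λ l → powP-scale (v l) Q k) i j ⟩
      sumP w (λ l → pow (v l) k ·P powP Q k) i j
        ≈⟨ sumP-coeff w _ i j ⟩
      sum (λ l → pow (v l) k *F powP Q k i j)
        ≈⟨ *-distribʳ-sum {w} _ (λ l → pow (v l) k) ⟨
      sum (λ l → pow (v l) k) *F powP Q k i j
        ≈⟨ *-congʳ (trans (sym (sumFin≈sum w _)) (proj₂ (everySum δ₀))) ⟩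
      δ₀ *F powP Q k i j ∎)
    where
    v : Fin w → Carrier
    v = proj₁ (everySum δ₀)

  module WithWeights (k₂ : ℕ) (node L : Fin (suc (suc k₂)) → Carrier)
      (weights : BinomialWeights (suc (suc k₂)) node L) (d : ℕ) where
    k₁ k D : ℕ
    k₁ = suc k₂
    k  = suc k₁
    D  = d + 2 * ((k ∸ 1) * (k ∸ 1))

    admissibleTerm : Carrier × Poly → Set ℓ
    admissibleTerm x = Admissible k D (proj₂ x)

    ScaledDecomposition : Poly → ℕ → Set (c ⊔ ℓ)
    ScaledDecomposition = Decomposition (scaledPower k) admissibleTerm

    -- p x^I y^J with I + J ≤ d, written I = r + a k, J = r′ + b k (0 ≤ r, r′ < k), equals
    -- Σ_t (p L_t) Q_t^k with Q_t = x^(a+r) y^(b+r′) + node_t x^a y^b, since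
    -- Σ_t L_t Q_t^k = M N^(k-1) = x^I y^J.
    monomialDecomposition : ∀ I J → I + J ≤ d → ∀ p → ScaledDecomposition (p ·P mono I J) k
    monomialDecomposition I J I+J≤d p =
      (λ t → p *F L t , Qv (node t)) , (λ t → Qv-isPoly (node t) , degree t) , expansion
      where
      a r b r′ : ℕ
      a = I / k
      r = I % k
      b = J / k
      r′ = J % k
      open Binomial a b r r′ using (Qv; Qv-isPoly; binomialTheorem; row)
      T : ℕ → ℕ → ℕ → Carrier
      T l i j = mono (k * a + l * r) (k * b + l * r′) i j
      degree : ∀ t → DegLe (powP (Qv (node t)) k) D
      degree t i j D<i+j = trans (binomialTheorem (node t) k i j) (monomialSum-degree k (row (node t) k) (λ l → k * a + l * r) (λ l → k * b + l * r′) D bound i j D<i+j)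
        where
        bound : ∀ l → l ≤ k → (k * a + l * r) + (k * b + l * r′) ≤ D
        bound l l≤k = ≤-trans (exponentBound k₁ a b r r′ l (≤-pred (m%n<n I k)) (≤-pred (m%n<n J k)) l≤k)
          (ℕ.+-monoˡ-≤ (2 * (k₁ * k₁)) (≡.subst₂ (λ I′ J′ → I′ + J′ ≤ d) (m≡m%n+[m/n]*n I k) (m≡m%n+[m/n]*n J k) I+J≤d))
      -- Σ_t L_t C(k,l) node_t^(k-l) T_l = C(k,l) μ_(k-l) T_l = δ(1,l) T_l
      collapse : ∀ i j l → sum (λ t → L t *F (row (node t) k l *F T l i j)) ≈ δ 1 l *F T l i j
      collapse i j l = begin
        sum (λ t → L t *F (row (node t) k l *F T l i j))
          ≈⟨ sum-cong-≋ {k} (λ t → regroup (L t) (binom k l) (pow (node t) (k ∸ l)) (T l i j)) ⟩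
        sum (λ t → (binom k l *F T l i j) *F (L t *F pow (node t) (k ∸ l)))
          ≈⟨ *-distribˡ-sum {k} _ (λ t → L t *F pow (node t) (k ∸ l)) ⟨
        (binom k l *F T l i j) *F moment k node L (k ∸ l)
          ≈⟨ xy∙z≈xz∙y _ _ _ ⟩
        (binom k l *F moment k node L (k ∸ l)) *F T l i j
          ≈⟨ *-congʳ (weights l) ⟩
        δ 1 l *F T l i j ∎
        where
        regroup : ∀ λ′ C X E → λ′ *F ((C *F X) *F E) ≈ (C *F E) *F (λ′ *F X)
        regroup λ′ C X E = begin
          λ′ *F ((C *F X) *F E) ≈⟨ *-swapˡ _ _ _ ⟩
          (C *F X) *F (λ′ *F E) ≈⟨ *-congˡ (*-comm _ _) ⟩
          (C *F X) *F (E *F λ′) ≈⟨ *-interchange _ _ _ _ ⟩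
          (C *F E) *F (X *F λ′) ≈⟨ *-congˡ (*-comm _ _) ⟩
          (C *F E) *F (λ′ *F X) ∎
      expansion : (p ·P mono I J) ≈P sumP k (λ t → scaledPower k (p *F L t , Qv (node t)))
      expansion i j = sym (begin
        sumP k (λ t → scaledPower k (p *F L t , Qv (node t))) i j
          ≈⟨ sumP-coeff k (λ t → scaledPower k (p *F L t , Qv (node t))) i j ⟩
        sum (λ t → (p *F L t) *F powP (Qv (node t)) k i j)
          ≈⟨ sum-cong-≋ {k} (λ t → trans (*-assoc p (L t) _) (*-congˡ (*-congˡ (binomialTheorem (node t) k i j)))) ⟩
        sum (λ t → p *F weighted t)
          ≈⟨ *-distribˡ-sum {k} p weighted ⟨
        p *F sum weighted
          ≈⟨ *-congˡ (trans (sum-cong-≋ {k} (λ t → *-distribˡ-sumUpTo k (L t) (binomialTerm t))) (sum-sumUpTo-comm k k (λ t l → L t *F (row (node t) k l *F T l i j)))) ⟩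
        p *F sumUpTo k (λ l → sum (λ t → L t *F (row (node t) k l *F T l i j)))
          ≈⟨ *-congˡ (sumUpTo-cong k (λ l _ → collapse i j l)) ⟩
        p *F sumUpTo k (λ l → δ 1 l *F T l i j)
          ≈⟨ *-congˡ (trans (sift k 1 (λ l → T l i j)) (*-identityˡ _)) ⟩
        p *F T 1 i j
          ≈⟨ *-congˡ (reflexive (≡.cong₂ (λ I′ J′ → mono I′ J′ i j)
               (≡.trans (exponent-one k a r) (≡.sym (m≡m%n+[m/n]*n I k)))
               (≡.trans (exponent-one k b r′) (≡.sym (m≡m%n+[m/n]*n J k))))) ⟩
        p *F mono I J i j ∎)
        where
        binomialTerm : Fin k → ℕ → Carrier
        binomialTerm t l = row (node t) k l *F T l i j
        weighted : Fin k → Carrier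
        weighted t = L t *F sumUpTo k (binomialTerm t)

    polynomialDecomposition : ∀ P → DegLe P d →
      ScaledDecomposition P (sumUpToℕ d (λ m → sumUpToℕ m (λ _ → k)))
    polynomialDecomposition P degP =
      decomposition-cong (scaledPower k) admissibleTerm (monomialExpansion d P degP)
        (decomposition-sumUpTo (scaledPower k) admissibleTerm d _ _ λ m m≤d →
          decomposition-sumUpTo (scaledPower k) admissibleTerm m _ (λ _ → k) λ I I≤m →
            monomialDecomposition I (m ∸ I) (≡.subst (_≤ d) (≡.sym (ℕ.m+[n∸m]≡n I≤m)) m≤d) (P I (m ∸ I)))

proposition3p3 : ∀ {c ℓ : Level} (F : Field c ℓ) (k : ℕ) → 2 ≤ k
    → FieldDefs.MoreThan F k
    → ¬ FieldDefs.CharDivides F k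
    → ∀ (d : ℕ) (P : FieldDefs.Poly F) → FieldDefs.DegLe F P d
    → (∃ λ s → (s * 2 ≤ k * ((d + 1) * (d + 2)))
         × Σ (Fin s → Field.Carrier F) λ δ → Σ (Fin s → FieldDefs.Poly F) λ Q →
             (∀ i → FieldDefs.IsPoly F (Q i))
           × (∀ i → FieldDefs.DegLe F (FieldDefs.powP F (Q i) k) (d + 2 * ((k ∸ 1) * (k ∸ 1))))
           × FieldDefs._≈P_ F P (FieldDefs.sumP F s (λ i → FieldDefs._·P_ F (δ i) (FieldDefs.powP F (Q i) k))))
    × (∀ (w : ℕ) → FieldDefs.IsWaringNumber F k w
       → ∃ λ s → (s * 2 ≤ k * w * ((d + 1) * (d + 2)))
         × Σ (Fin s → FieldDefs.Poly F) λ Q →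
             (∀ i → FieldDefs.IsPoly F (Q i))
           × (∀ i → FieldDefs.DegLe F (FieldDefs.powP F (Q i) k) (d + 2 * ((k ∸ 1) * (k ∸ 1))))
           × FieldDefs._≈P_ F P (FieldDefs.sumP F s (λ i → FieldDefs.powP F (Q i) k)))
proposition3p3 F (suc (suc k₂)) (s≤s (s≤s z≤n)) moreThan k∤char d P degP =
    (s , ≤-reflexive (monomialCount k d) , scaledForm {k} {D} scaled)
  , λ w (everySum , _) →
      s * w , ≤-reflexive (scaleCount k w ((d + 1) * (d + 2)) s (monomialCount k d)) ,
      powerForm {k} {D} (decomposition-refine {term = scaledPower k} {admissibleTerm} {power k} {Admissible k D}
                                      w (scaledPower-asPowers k D w everySum) s scaled)
  where
  open Development F
  weights : Σ (Fin (suc (suc k₂)) → Field.Carrier F) λ node → Σ (Fin (suc (suc k₂)) → Field.Carrier F) λ L →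
              BinomialWeights (suc (suc k₂)) node L
  weights = binomialWeights k₂ moreThan k∤char
  open WithWeights k₂ (proj₁ weights) (proj₁ (proj₂ weights)) (proj₂ (proj₂ weights)) d
  s : ℕ
  s = sumUpToℕ d (λ m → sumUpToℕ m (λ _ → k))
  scaled : ScaledDecomposition P s
  scaled = polynomialDecomposition P degP
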